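{- Let $w\in\mathfrak{S}_n$ and $u\le w$. If $v\in\mathfrak{S}_n$ satisfies $v'=u$, then $C(v)\subset D_w(u)^{\vee}$. Therefore $\bigcup_{v'=u}C(v)\subset D_w(u)^\vee$.
   Context: Permutations are in one-line notation; $\le$ is Bruhat order, $\ell$ length, $t_{a,b}$ the transposition of $a,b$. $C(v)=\{(a_1,\dots,a_n)\in\mathbb{R}^n : a_{v(1)}\le\cdots\le a_{v(n)}\}$; $D^\vee$ denotes the dual cone with respect to the standard inner product. Operation $v\mapsto v'$ (depending on $w$): $S\!\uparrow$ is the increasing tuple of a set $S$, $w^{(d)}=\{w(1),\dots,w(d)\}\!\uparrow$, increasing tuples are compared componentwise; $i_1=\min\{i : v(i)\le w(1)\}$, $i_k=\min\{i\in[n]\setminus\{i_1,\dots,i_{k-1}\}: \{v(i_1),\dots,v(i_{k-1}),v(i)\}\!\uparrow\le w^{(k)}\}$ for $k\ge2$, and $v'=v(i_1)\cdots v(i_n)$. For $u\le w$: $\widetilde{E}_w(u)=\{(u(i),u(j)) : 1\le i<j\le n,\ t_{u(i),u(j)}u\le w,\ |\ell(u)-\ell(t_{u(i),u(j)}u)|=1\}$; with $(a,b)+(b,c)=(a,c)$, an element is decomposable if it is a sum of some other elements of $\widetilde{E}_w(u)$; $E_w(u)$ is the set of indecomposable elements; $D_w(u)$ is the cone spanned by $\{e_b-e_a : (a,b)\in E_w(u)\}$.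
   Formalization: The cones $C(v)$, $D_w(u)$ and $D_w(u)^\vee$ consist only of points with rational coordinates, lying in ℚ^n rather than ℝ^n. -}

module Defs where

open import Data.Nat as ℕ using (ℕ; zero; suc)
open import Data.Fin as F using (Fin; toℕ)
open import Data.Fin.Properties as FP using (_≟_)
open import Data.Fin.Permutation using (Permutation′; _⟨$⟩ʳ_; transpose; _∘ₚ_)
open import Data.List as L using (List; []; _∷_; allFin; take; map; filter; cartesianProduct; foldr)
open import Data.List.Membership.Propositional using (_∉_)
open import Data.List.Relation.Binary.Pointwise using (Pointwise)
open import Data.List.Relation.Unary.All using (All)
open import Data.Product using (Σ; ∃; ∃₂; _×_; _,_; proj₁; proj₂)
open import Relation.Binary.PropositionalEquality using (_≡_)
open import Relation.Nullary using (¬_; does)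
open import Relation.Nullary.Decidable using (_×-dec_)
open import Data.Bool using (if_then_else_)
open import Data.Rational as Q using (ℚ; 0ℚ; 1ℚ)
import Data.List.Sort

-- Permutations of [n] = Fin n, in one-line notation v(i) = v ⟨$⟩ʳ i.

Perm : ℕ → Set
Perm n = Permutation′ n

_≈ₚ_ : ∀ {n} → Perm n → Perm n → Set
u ≈ₚ w = ∀ i → u ⟨$⟩ʳ i ≡ w ⟨$⟩ʳ i

-- left multiplication by the transposition t_{a,b}:  (t_{a,b} u)(i) = t_{a,b}(u(i))
-- (stdlib's _∘ₚ_ is diagrammatic: (π ∘ₚ ρ)(i) = ρ(π(i)))
tmul : ∀ {n} → Fin n → Fin n → Perm n → Perm n
tmul a b u = u ∘ₚ transpose a b

len : ∀ {n} → Perm n → ℕ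
len {n} u = L.length (filter (λ p → (proj₁ p F.<? proj₂ p) ×-dec (u ⟨$⟩ʳ proj₂ p F.<? u ⟨$⟩ʳ proj₁ p))
                             (cartesianProduct (allFin n) (allFin n)))

data _≤B_ {n} (u : Perm n) : Perm n → Set where
  base : ∀ {w} → u ≈ₚ w → u ≤B w
  step : ∀ {v w} (a b : Fin n) → u ≤B v → len v ℕ.< len (tmul a b v) →
         w ≈ₚ tmul a b v → u ≤B w

module _ {n : ℕ} where
  open Data.List.Sort (FP.≤-decTotalOrder n) using (sort)

  -- S↑ : increasing tuple of a set (given as a list of distinct elements)
  _↑ : List (Fin n) → List (Fin n)
  S ↑ = sort S
  infix 30 _↑
  infix 4 _≤tup_

  _≤tup_ : List (Fin n) → List (Fin n) → Set
  xs ≤tup ys = Pointwise F._≤_ xs ys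

  firstVals : ℕ → Perm n → List (Fin n)
  firstVals d w = take d (map (w ⟨$⟩ʳ_) (allFin n))

  wd : ℕ → Perm n → List (Fin n)
  wd d w = firstVals d w ↑

  -- given the chosen positions is(0..n-1) (i.e. i_1,…,i_n) the candidate set for i_{k+1}:
  -- i ∉ {i_1,…,i_k} and {v(i_1),…,v(i_k),v(i)}↑ ≤ w^{(k+1)}
  Cand : Perm n → Perm n → (Fin n → Fin n) → Fin n → Fin n → Set
  Cand w v is k i =
    (i ∉ take (toℕ k) (map is (allFin n))) ×
    (((v ⟨$⟩ʳ i) ∷ take (toℕ k) (map (λ j → v ⟨$⟩ʳ is j) (allFin n))) ↑ ≤tup wd (suc (toℕ k)) w)

  IsMin : (Fin n → Set) → Fin n → Set
  IsMin P i = P i × (∀ j → P j → i F.≤ j)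

  Greedy : Perm n → Perm n → (Fin n → Fin n) → Set
  Greedy w v is = ∀ k → IsMin (Cand w v is k) (is k)

  -- v' = u   (v' = v(i_1) ⋯ v(i_n), w fixed)
  PrimeEq : Perm n → Perm n → Perm n → Set
  PrimeEq w v u = Σ (Fin n → Fin n) λ is → Greedy w v is × (∀ k → v ⟨$⟩ʳ is k ≡ u ⟨$⟩ʳ k)

  absDiff : ℕ → ℕ → ℕ
  absDiff x y = (x ℕ.∸ y) ℕ.+ (y ℕ.∸ x)

  Etilde : Perm n → Perm n → Fin n → Fin n → Set
  Etilde w u a b = ∃₂ λ i j → i F.< j × u ⟨$⟩ʳ i ≡ a × u ⟨$⟩ʳ j ≡ b ×
                   (tmul a b u ≤B w) × absDiff (len u) (len (tmul a b u)) ≡ 1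

  -- chains (c₀,c₁)+(c₁,c₂)+⋯+(c_{m-1},c_m) of m summands, each satisfying R
  data Chain (R : Fin n → Fin n → Set) : Fin n → Fin n → ℕ → Set where
    one  : ∀ {a b} → R a b → Chain R a b 1
    cons : ∀ {a c b m} → R a c → Chain R c b m → Chain R a b (suc m)

  Decomposable : Perm n → Perm n → Fin n → Fin n → Set
  Decomposable w u a b =
    ∃ λ m → 2 ℕ.≤ m × Chain (λ x y → Etilde w u x y × ¬ (x ≡ a × y ≡ b)) a b m

  E : Perm n → Perm n → Fin n → Fin n → Set
  E w u a b = Etilde w u a b × ¬ Decomposable w u a b

  Vecℚ : Set
  Vecℚ = Fin n → ℚ

  sumℚ : List ℚ → ℚ
  sumℚ = foldr Q._+_ 0ℚ

  ⟨_,_⟩ : Vecℚ → Vecℚ → ℚ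
  ⟨ x , y ⟩ = sumℚ (map (λ i → x i Q.* y i) (allFin n))

  e : Fin n → Vecℚ
  e b i = if does (i ≟ b) then 1ℚ else 0ℚ

  Cone : (Vecℚ → Set) → Vecℚ → Set
  Cone G y = ∃ λ (gs : List (ℚ × Vecℚ)) →
    All (λ cg → 0ℚ Q.≤ proj₁ cg × G (proj₂ cg)) gs ×
    (∀ i → y i ≡ sumℚ (map (λ cg → proj₁ cg Q.* proj₂ cg i) gs))

  Dual : (Vecℚ → Set) → Vecℚ → Set
  Dual D x = ∀ y → D y → 0ℚ Q.≤ ⟨ x , y ⟩

  C : Perm n → Vecℚ → Set
  C v x = ∀ (i j : Fin n) → toℕ j ≡ suc (toℕ i) → x (v ⟨$⟩ʳ i) Q.≤ x (v ⟨$⟩ʳ j)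

  Dw : Perm n → Perm n → Vecℚ → Set
  Dw w u = Cone (λ g → ∃₂ λ a b → E w u a b × (∀ i → g i ≡ e b i Q.- e a i))

-- Let (a, b) ∈ Ẽ_w(u), say a = u(p), b = u(q) with p < q, and let i_1, …, i_n be the greedy
-- positions with v(i_k) = u(k).  Since t_{a,b} u ≤ w, the tableau criterion for Bruhat order
-- bounds the sorted first p+1 values of t_{a,b} u, namely {u(1), …, u(p), u(q)}, by w^{(p+1)}.
-- These are the values {v(i_1), …, v(i_p), v(i_q)}, so i_q was a candidate at step p+1 of the
-- greedy rule and minimality gives i_p ≤ i_q.  Hence x_a = x_{v(i_p)} ≤ x_{v(i_q)} = x_b for
-- every x ∈ C(v): x pairs nonnegatively with each generator e_b − e_a of D_w(u), hence with
-- the whole cone.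
--
-- The tableau criterion is proved one Bruhat step at a time.  Swapping the entries of an
-- inversion never increases the number of inversions, so a length-increasing transposition
-- swaps an ascent, and swapping an ascent raises every sorted prefix componentwise.

module Submission where

open import Defs
open import Data.Bool using (Bool; true; false; if_then_else_; not; _∧_)
open import Data.Empty using (⊥-elim)
open import Data.Fin as F using (Fin; toℕ; _<_)
import Data.Fin.Properties as FP
open import Data.Fin.Permutation using (Permutation′; _⟨$⟩ʳ_; _⟨$⟩ˡ_; transpose; inverseʳ)
open import Data.List as L
  using (List; []; _∷_; take; map; tabulate; allFin; filter; cartesianProduct; length)
open import Data.List.Membership.Propositional using (_∈_; _∉_)
import Data.List.Properties as LP
open import Data.List.Relation.Binary.Permutation.Propositional using (_↭_; ↭-sym; ↭-trans)
open import Data.List.Relation.Unary.Any using (here; there)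
open import Data.Nat as Nat using (ℕ; zero; suc; z≤n; s≤s)
import Data.Nat.Properties as NP
open import Data.Product using (∃; ∃₂; _×_; _,_; proj₁; proj₂)
open import Data.Rational as Q using (0ℚ)
import Data.Rational.Properties as QP
open import Data.Sum using (inj₁; inj₂)
open import Function using (_∘_; id)
open import Function.Bundles using (Injection)
open import Function.Properties.Inverse using (↔⇒↣)
open import Relation.Binary.Bundles using (DecTotalOrder; Preorder; TotalPreorder)
open import Relation.Binary.PropositionalEquality
open import Relation.Nullary using (¬_; Dec; yes; no; does)
open import Relation.Nullary.Decidable using (_×-dec_; ¬?; dec-true; dec-false)
open import Relation.Unary using (Pred; Decidable)

module _ {n : ℕ} where

  transpose-matchˡ : (i j : Fin n) → transpose i j ⟨$⟩ʳ i ≡ j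
  transpose-matchˡ i j with i FP.≟ i
  ... | yes _  = refl
  ... | no i≢i = ⊥-elim (i≢i refl)

  transpose-matchʳ : (i j : Fin n) → transpose i j ⟨$⟩ʳ j ≡ i
  transpose-matchʳ i j with j FP.≟ i
  ... | yes j≡i = j≡i
  ... | no _ with j FP.≟ j
  ...   | yes _  = refl
  ...   | no j≢j = ⊥-elim (j≢j refl)

  transpose-fix : ∀ {i j k : Fin n} → k ≢ i → k ≢ j → transpose i j ⟨$⟩ʳ k ≡ k
  transpose-fix {i} {j} {k} k≢i k≢j with k FP.≟ i
  ... | yes k≡i = ⊥-elim (k≢i k≡i)
  ... | no _ with k FP.≟ j
  ...   | yes k≡j = ⊥-elim (k≢j k≡j)
  ...   | no _    = refl

  data TransposeView (i j : Fin n) : Fin n → Set where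
    at-i      : TransposeView i j i
    at-j      : TransposeView i j j
    elsewhere : ∀ {k} → k ≢ i → k ≢ j → TransposeView i j k

  transposeView : (i j k : Fin n) → TransposeView i j k
  transposeView i j k with k FP.≟ i | k FP.≟ j
  ... | yes refl | _        = at-i
  ... | no _     | yes refl = at-j
  ... | no k≢i   | no k≢j   = elsewhere k≢i k≢j

  transpose-comm : (i j k : Fin n) → transpose i j ⟨$⟩ʳ k ≡ transpose j i ⟨$⟩ʳ k
  transpose-comm i j k with transposeView i j k
  ... | at-i              = trans (transpose-matchˡ i j) (sym (transpose-matchʳ j i))
  ... | at-j              = trans (transpose-matchʳ i j) (sym (transpose-matchˡ j i))
  ... | elsewhere k≢i k≢j = trans (transpose-fix k≢i k≢j) (sym (transpose-fix k≢j k≢i))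

  transpose-diag : (i k : Fin n) → transpose i i ⟨$⟩ʳ k ≡ k
  transpose-diag i k with transposeView i i k
  ... | at-i            = transpose-matchˡ i i
  ... | at-j            = transpose-matchˡ i i
  ... | elsewhere k≢i _ = transpose-fix k≢i k≢i

  perm-injective : (π : Perm n) {k l : Fin n} → π ⟨$⟩ʳ k ≡ π ⟨$⟩ʳ l → k ≡ l
  perm-injective π = Injection.injective (↔⇒↣ π)

  transpose-conjugate : (π : Perm n) (i j k : Fin n) →
    transpose (π ⟨$⟩ʳ i) (π ⟨$⟩ʳ j) ⟨$⟩ʳ (π ⟨$⟩ʳ k) ≡ π ⟨$⟩ʳ (transpose i j ⟨$⟩ʳ k)
  transpose-conjugate π i j k with transposeView i j k
  ... | at-i = trans (transpose-matchˡ (π ⟨$⟩ʳ i) (π ⟨$⟩ʳ j)) (cong (π ⟨$⟩ʳ_) (sym (transpose-matchˡ i j)))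
  ... | at-j = trans (transpose-matchʳ (π ⟨$⟩ʳ i) (π ⟨$⟩ʳ j)) (cong (π ⟨$⟩ʳ_) (sym (transpose-matchʳ i j)))
  ... | elsewhere k≢i k≢j = trans (transpose-fix (k≢i ∘ perm-injective π) (k≢j ∘ perm-injective π))
                                  (cong (π ⟨$⟩ʳ_) (sym (transpose-fix k≢i k≢j)))

-- Counting inversions

module _ where
  open import Algebra.Properties.CommutativeMonoid.Sum NP.+-0-commutativeMonoid
    using (sum; sum-syntax; sum-cong-≗; ∑-distrib-+; sum-permute)
  open Nat using (_≤_; _+_)

  𝟙 : ∀ {p} {P : Set p} → Dec P → ℕ
  𝟙 P? = if does P? then 1 else 0

  𝟙-mono : ∀ {p q} {P : Set p} {Q : Set q} (P? : Dec P) (Q? : Dec Q) → (P → Q) → 𝟙 P? ≤ 𝟙 Q?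
  𝟙-mono (no _)  _       _   = z≤n
  𝟙-mono (yes _) (yes _) _   = NP.≤-refl
  𝟙-mono (yes p) (no ¬q) P⇒Q = ⊥-elim (¬q (P⇒Q p))

  length-filter-tabulate : ∀ {a p} {A : Set a} {P : Pred A p} (P? : Decidable P) {m} (f : Fin m → A) →
    length (filter P? (tabulate f)) ≡ ∑[ k < m ] 𝟙 (P? (f k))
  length-filter-tabulate P? {zero}  f = refl
  length-filter-tabulate P? {suc m} f with does (P? (f F.zero))
  ... | true  = cong suc (length-filter-tabulate P? (f ∘ F.suc))
  ... | false = length-filter-tabulate P? (f ∘ F.suc)

  length-filter-cartesianProduct : ∀ {a b p} {A : Set a} {B : Set b} {P : Pred (A × B) p}
    (P? : Decidable P) {m k} (g : Fin m → A) (h : Fin k → B) →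
    length (filter P? (cartesianProduct (tabulate g) (tabulate h))) ≡ ∑[ p < m ] ∑[ q < k ] 𝟙 (P? (g p , h q))
  length-filter-cartesianProduct P? {zero}  g h = refl
  length-filter-cartesianProduct P? {suc m} g h = begin
    length (filter P? (row L.++ rows))                ≡⟨ cong length (LP.filter-++ P? row rows) ⟩
    length (filter P? row L.++ filter P? rows)        ≡⟨ LP.length-++ (filter P? row) ⟩
    length (filter P? row) + length (filter P? rows)  ≡⟨ cong₂ _+_ first-row other-rows ⟩
    ∑[ q < _ ] 𝟙 (P? (g F.zero , h q)) + ∑[ p < m ] ∑[ q < _ ] 𝟙 (P? (g (F.suc p) , h q)) ∎
    where
    open ≡-Reasoning
    row  = map (g F.zero ,_) (tabulate h)
    rows = cartesianProduct (tabulate (g ∘ F.suc)) (tabulate h)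
    first-row = trans (cong (length ∘ filter P?) (LP.map-tabulate h (g F.zero ,_)))
                      (length-filter-tabulate P? (λ q → g F.zero , h q))
    other-rows = length-filter-cartesianProduct P? (g ∘ F.suc) h

  ∑-mono-≤ : ∀ {m} {f g : Fin m → ℕ} → (∀ k → f k ≤ g k) → sum f ≤ sum g
  ∑-mono-≤ {zero}  _   = z≤n
  ∑-mono-≤ {suc m} f≤g = NP.+-mono-≤ (f≤g F.zero) (∑-mono-≤ (f≤g ∘ F.suc))

  ∑∑-distrib-+ : ∀ {m k} (F G : Fin m → Fin k → ℕ) →
    ∑[ p < m ] ∑[ q < k ] (F p q + G p q) ≡ ∑[ p < m ] ∑[ q < k ] F p q + ∑[ p < m ] ∑[ q < k ] G p q
  ∑∑-distrib-+ F G = trans (sum-cong-≗ (λ p → ∑-distrib-+ (F p) (G p)))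
                           (∑-distrib-+ (λ p → sum (F p)) (λ p → sum (G p)))

  ∑∑-permute : ∀ {m} (σ : Permutation′ m) (F : Fin m → Fin m → ℕ) →
    ∑[ p < m ] ∑[ q < m ] F (σ ⟨$⟩ʳ p) (σ ⟨$⟩ʳ q) ≡ ∑[ p < m ] ∑[ q < m ] F p q
  ∑∑-permute σ F = sym (trans (sum-permute (λ p → sum (F p)) σ)
                              (sum-cong-≗ (λ p → sum-permute (F (σ ⟨$⟩ʳ p)) σ)))

  -- Reindexing by σ × σ only on a σ-invariant set R of pairs: the pair map is still a bijection.
  ∑∑-permute-on : ∀ {m} (σ : Permutation′ m) (R : Fin m → Fin m → Bool) →
    (∀ p q → R (σ ⟨$⟩ʳ p) (σ ⟨$⟩ʳ q) ≡ R p q) → (F : Fin m → Fin m → ℕ) →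
    ∑[ p < m ] ∑[ q < m ] (if R p q then F (σ ⟨$⟩ʳ p) (σ ⟨$⟩ʳ q) else F p q) ≡ ∑[ p < m ] ∑[ q < m ] F p q
  ∑∑-permute-on {m} σ R R-invariant F = begin
    ∑∑ (λ p q → if R p q then F (σ ⟨$⟩ʳ p) (σ ⟨$⟩ʳ q) else F p q)
      ≡⟨ ∑∑-cong split ⟩
    ∑∑ (λ p q → F-on (σ ⟨$⟩ʳ p) (σ ⟨$⟩ʳ q) + F-off p q)
      ≡⟨ ∑∑-distrib-+ (λ p q → F-on (σ ⟨$⟩ʳ p) (σ ⟨$⟩ʳ q)) F-off ⟩
    ∑∑ (λ p q → F-on (σ ⟨$⟩ʳ p) (σ ⟨$⟩ʳ q)) + ∑∑ F-off
      ≡⟨ cong (_+ ∑∑ F-off) (∑∑-permute σ F-on) ⟩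
    ∑∑ F-on + ∑∑ F-off
      ≡⟨ ∑∑-distrib-+ F-on F-off ⟨
    ∑∑ (λ p q → F-on p q + F-off p q)
      ≡⟨ ∑∑-cong recombine ⟩
    ∑∑ F ∎
    where
    open ≡-Reasoning
    ∑∑ : (Fin m → Fin m → ℕ) → ℕ
    ∑∑ G = ∑[ p < m ] ∑[ q < m ] G p q
    ∑∑-cong : ∀ {G H : Fin m → Fin m → ℕ} → (∀ p q → G p q ≡ H p q) → ∑∑ G ≡ ∑∑ H
    ∑∑-cong G≡H = sum-cong-≗ (λ p → sum-cong-≗ (G≡H p))
    F-on F-off : Fin m → Fin m → ℕ
    F-on  p q = if R p q then F p q else 0
    F-off p q = if R p q then 0 else F p q
    split : ∀ p q → (if R p q then F (σ ⟨$⟩ʳ p) (σ ⟨$⟩ʳ q) else F p q) ≡ F-on (σ ⟨$⟩ʳ p) (σ ⟨$⟩ʳ q) + F-off p q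
    split p q rewrite R-invariant p q with R p q
    ... | true  = sym (NP.+-identityʳ _)
    ... | false = refl
    recombine : ∀ p q → F-on p q + F-off p q ≡ F p q
    recombine p q with R p q
    ... | true  = NP.+-identityʳ _
    ... | false = refl

  module _ {n : ℕ} where

    Inversion : Perm n → Fin n → Fin n → Set
    Inversion f p q = p < q × f ⟨$⟩ʳ q < f ⟨$⟩ʳ p

    inversion? : (f : Perm n) (p q : Fin n) → Dec (Inversion f p q)
    inversion? f p q = (p F.<? q) ×-dec (f ⟨$⟩ʳ q F.<? f ⟨$⟩ʳ p)

    len≡∑∑inversions : (f : Perm n) → len f ≡ ∑[ p < n ] ∑[ q < n ] 𝟙 (inversion? f p q)
    len≡∑∑inversions f =
      length-filter-cartesianProduct (λ pq → inversion? f (proj₁ pq) (proj₂ pq)) {n} {n} id id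

  -- g is f with the entries of the inversion (i, j) swapped.  Pairs touching the open interval
  -- (i, j) keep their inversions; every other inversion of g is moved by σ × σ to one of f.
  module SwapInversion {n : ℕ} {f g : Perm n} {i j : Fin n} (i<j : i < j)
    (fj<fi : f ⟨$⟩ʳ j < f ⟨$⟩ʳ i) (g≗fσ : ∀ k → g ⟨$⟩ʳ k ≡ f ⟨$⟩ʳ (transpose i j ⟨$⟩ʳ k)) where

    σ : Fin n → Fin n
    σ k = transpose i j ⟨$⟩ʳ k

    Between : Fin n → Set
    Between k = i < k × k < j

    between? : ∀ k → Dec (Between k)
    between? k = (i F.<? k) ×-dec (k F.<? j)

    Outside : Fin n → Fin n → Set
    Outside p q = ¬ Between p × ¬ Between q

    outside? : ∀ p q → Dec (Outside p q)
    outside? p q = ¬? (between? p) ×-dec ¬? (between? q)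

    between⇒fixed : ∀ {k} → Between k → σ k ≡ k
    between⇒fixed (i<k , k<j) = transpose-fix (FP.<⇒≢ i<k ∘ sym) (FP.<⇒≢ k<j)

    between-σ : ∀ {k} → TransposeView i j k → Between (σ k) → Between k
    between-σ at-i b = ⊥-elim (FP.<-irrefl refl (subst (_< j) (transpose-matchˡ i j) (proj₂ b)))
    between-σ at-j b = ⊥-elim (FP.<-irrefl refl (subst (i <_) (transpose-matchʳ i j) (proj₁ b)))
    between-σ (elsewhere k≢i k≢j) b = subst Between (transpose-fix k≢i k≢j) b

    outside-invariant : ∀ p q → does (outside? (σ p) (σ q)) ≡ does (outside? p q)
    outside-invariant p q = cong₂ (λ x y → not x ∧ not y) (does-between-σ p) (does-between-σ q)
      where
      does-between-σ : ∀ k → does (between? (σ k)) ≡ does (between? k)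
      does-between-σ k with between? k
      ... | yes b = trans (dec-true (between? (σ k)) (subst Between (sym (between⇒fixed b)) b))
                          (sym (dec-true (between? k) b))
      ... | no ¬b = trans (dec-false (between? (σ k)) (¬b ∘ between-σ (transposeView i j k)))
                          (sym (dec-false (between? k) ¬b))

    beyond-j : ∀ {q} → ¬ Between q → i < q → q ≢ j → j < q
    beyond-j ¬b i<q q≢j = FP.≤∧≢⇒< (NP.≮⇒≥ (λ q<j → ¬b (i<q , q<j))) (q≢j ∘ sym)

    before-i : ∀ {p} → ¬ Between p → p < j → p ≢ i → p < i
    before-i ¬b p<j p≢i = FP.≤∧≢⇒< (NP.≮⇒≥ (λ i<p → ¬b (i<p , p<j))) p≢i

    σ-mono-outside : ∀ {p q} → TransposeView i j p → TransposeView i j q → Outside p q →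
                     p < q → f ⟨$⟩ʳ σ q < f ⟨$⟩ʳ σ p → σ p < σ q
    σ-mono-outside at-i at-i _ i<i _ = ⊥-elim (FP.<-irrefl refl i<i)
    σ-mono-outside at-i at-j _ _ fσj<fσi
      rewrite transpose-matchˡ i j | transpose-matchʳ i j = ⊥-elim (NP.<-asym fj<fi fσj<fσi)
    σ-mono-outside at-i (elsewhere q≢i q≢j) (_ , ¬bq) i<q _
      rewrite transpose-matchˡ i j | transpose-fix q≢i q≢j = beyond-j ¬bq i<q q≢j
    σ-mono-outside at-j at-i _ j<i _ = ⊥-elim (NP.<-asym i<j j<i)
    σ-mono-outside at-j at-j _ j<j _ = ⊥-elim (FP.<-irrefl refl j<j)
    σ-mono-outside at-j (elsewhere q≢i q≢j) _ j<q _
      rewrite transpose-matchʳ i j | transpose-fix q≢i q≢j = FP.<-trans i<j j<q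
    σ-mono-outside (elsewhere p≢i p≢j) at-i _ p<i _
      rewrite transpose-matchˡ i j | transpose-fix p≢i p≢j = FP.<-trans p<i i<j
    σ-mono-outside (elsewhere p≢i p≢j) at-j (¬bp , _) p<j _
      rewrite transpose-matchʳ i j | transpose-fix p≢i p≢j = before-i ¬bp p<j p≢i
    σ-mono-outside (elsewhere p≢i p≢j) (elsewhere q≢i q≢j) _ p<q _
      rewrite transpose-fix p≢i p≢j | transpose-fix q≢i q≢j = p<q

    inversion-outside : ∀ {p q} → Outside p q → Inversion g p q → Inversion f (σ p) (σ q)
    inversion-outside {p} {q} out (p<q , gq<gp) =
      σ-mono-outside (transposeView i j p) (transposeView i j q) out p<q fσq<fσp , fσq<fσp
      where fσq<fσp = subst₂ _<_ (g≗fσ q) (g≗fσ p) gq<gp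

    g-at-i : g ⟨$⟩ʳ i ≡ f ⟨$⟩ʳ j
    g-at-i = trans (g≗fσ i) (cong (f ⟨$⟩ʳ_) (transpose-matchˡ i j))

    g-at-j : g ⟨$⟩ʳ j ≡ f ⟨$⟩ʳ i
    g-at-j = trans (g≗fσ j) (cong (f ⟨$⟩ʳ_) (transpose-matchʳ i j))

    g-elsewhere : ∀ {k} → k ≢ i → k ≢ j → g ⟨$⟩ʳ k ≡ f ⟨$⟩ʳ k
    g-elsewhere k≢i k≢j = trans (g≗fσ _) (cong (f ⟨$⟩ʳ_) (transpose-fix k≢i k≢j))

    between⇒g≡f : ∀ {k} → Between k → g ⟨$⟩ʳ k ≡ f ⟨$⟩ʳ k
    between⇒g≡f (i<k , k<j) = g-elsewhere (FP.<⇒≢ i<k ∘ sym) (FP.<⇒≢ k<j)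

    inversion-from-between-p : ∀ {p q} → TransposeView i j q → Between p → Inversion g p q → Inversion f p q
    inversion-from-between-p at-i (i<p , _) (p<i , _) = ⊥-elim (NP.<-asym p<i i<p)
    inversion-from-between-p at-j bp (p<j , gj<gp) =
      p<j , FP.<-trans fj<fi (subst₂ _<_ g-at-j (between⇒g≡f bp) gj<gp)
    inversion-from-between-p (elsewhere q≢i q≢j) bp (p<q , gq<gp) =
      p<q , subst₂ _<_ (g-elsewhere q≢i q≢j) (between⇒g≡f bp) gq<gp

    inversion-from-between-q : ∀ {p q} → TransposeView i j p → Between q → Inversion g p q → Inversion f p q
    inversion-from-between-q at-i bq (i<q , gq<gi) =
      i<q , FP.<-trans (subst₂ _<_ (between⇒g≡f bq) g-at-i gq<gi) fj<fi
    inversion-from-between-q at-j (_ , q<j) (j<q , _) = ⊥-elim (NP.<-asym q<j j<q)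
    inversion-from-between-q (elsewhere p≢i p≢j) bq (p<q , gq<gp) =
      p<q , subst₂ _<_ (between⇒g≡f bq) (g-elsewhere p≢i p≢j) gq<gp

    inversion-inside : ∀ {p q} → ¬ Outside p q → Inversion g p q → Inversion f p q
    inversion-inside {p} {q} ¬out with between? p | between? q
    ... | yes bp | _      = inversion-from-between-p (transposeView i j q) bp
    ... | no ¬bp | yes bq = inversion-from-between-q (transposeView i j p) bq
    ... | no ¬bp | no ¬bq = ⊥-elim (¬out (¬bp , ¬bq))

    len-swapped≤len : len g ≤ len f
    len-swapped≤len = begin
      len g                                        ≡⟨ len≡∑∑inversions g ⟩
      ∑[ p < n ] ∑[ q < n ] 𝟙 (inversion? g p q)   ≤⟨ ∑-mono-≤ (λ p → ∑-mono-≤ (pointwise p)) ⟩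
      ∑[ p < n ] ∑[ q < n ] (if does (outside? p q) then Iσ p q else I p q)
        ≡⟨ ∑∑-permute-on (transpose i j) (λ p q → does (outside? p q)) outside-invariant I ⟩
      ∑[ p < n ] ∑[ q < n ] I p q                  ≡⟨ len≡∑∑inversions f ⟨
      len f                                        ∎
      where
      open NP.≤-Reasoning
      I Iσ : Fin n → Fin n → ℕ
      I p q = 𝟙 (inversion? f p q)
      Iσ p q = I (σ p) (σ q)
      pointwise : ∀ p q → 𝟙 (inversion? g p q) ≤ (if does (outside? p q) then Iσ p q else I p q)
      pointwise p q = by-cases (outside? p q)
        where
        by-cases : (o : Dec (Outside p q)) → 𝟙 (inversion? g p q) ≤ (if does o then Iσ p q else I p q)
        by-cases (yes out) = 𝟙-mono (inversion? g p q) (inversion? f (σ p) (σ q)) (inversion-outside out)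
        by-cases (no ¬out) = 𝟙-mono (inversion? g p q) (inversion? f p q) (inversion-inside ¬out)

-- Sorted prefixes

module _ {a} {A : Set a} where
  open import Data.List.Relation.Binary.Permutation.Propositional
    using (↭-refl; ↭-prep; ↭-swap; ↭-reflexive; module PermutationReasoning)
  open import Data.List.Relation.Binary.Permutation.Propositional.Properties using (∷↭∷ʳ; drop-∷)
  open import Data.Vec.Functional using (updateAt)
  open import Data.Vec.Functional.Properties using (updateAt-updates; updateAt-minimal)

  ∈-take-mono : ∀ {x : A} xs {j k} → j Nat.≤ k → x ∈ take j xs → x ∈ take k xs
  ∈-take-mono (y ∷ xs) {suc j} {suc k} _         (here x≡y) = here x≡y
  ∈-take-mono (y ∷ xs) {suc j} {suc k} (s≤s j≤k) (there x∈) = there (∈-take-mono xs j≤k x∈)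

  prefix : ∀ {n} → ℕ → (Fin n → A) → List A
  prefix d f = take d (tabulate f)

  prefix-cong : ∀ {n} {f g : Fin n → A} d → (∀ k → toℕ k Nat.< d → f k ≡ g k) → prefix d f ≡ prefix d g
  prefix-cong {zero}  d       _   = refl
  prefix-cong {suc n} zero    _   = refl
  prefix-cong {suc n} (suc d) f≡g =
    cong₂ _∷_ (f≡g F.zero (s≤s z≤n)) (prefix-cong d (λ k k<d → f≡g (F.suc k) (s≤s k<d)))

  prefix-suc-↭ : ∀ {n} (f : Fin n → A) (p : Fin n) → prefix (suc (toℕ p)) f ↭ f p ∷ prefix (toℕ p) f
  prefix-suc-↭ f p = ↭-trans (↭-reflexive (LP.take-suc-tabulate f p)) (↭-sym (∷↭∷ʳ (f p) _))

  prefix-update-↭ : ∀ {n} (f g : Fin n → A) {d} (i : Fin n) → toℕ i Nat.< d →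
    (∀ k → toℕ k Nat.< d → k ≢ i → f k ≡ g k) → ∃ λ zs → prefix d f ↭ f i ∷ zs × prefix d g ↭ g i ∷ zs
  prefix-update-↭ {suc n} f g {suc d} F.zero _ f≡g =
    prefix d (f ∘ F.suc) , ↭-refl ,
    ↭-prep (g F.zero) (↭-reflexive (prefix-cong d (λ k k<d → sym (f≡g (F.suc k) (s≤s k<d) λ ()))))
  prefix-update-↭ {suc n} f g {suc d} (F.suc i) (s≤s i<d) f≡g
    with prefix-update-↭ (f ∘ F.suc) (g ∘ F.suc) i i<d
           (λ k k<d k≢i → f≡g (F.suc k) (s≤s k<d) (k≢i ∘ FP.suc-injective))
  ... | zs , f↭ , g↭ =
    f F.zero ∷ zs ,
    ↭-trans (↭-prep _ f↭) (↭-swap _ _ ↭-refl) ,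
    ↭-trans (↭-prep _ g↭) (↭-trans (↭-swap _ _ ↭-refl)
      (↭-reflexive (cong (λ x → g (F.suc i) ∷ x ∷ zs) (sym (f≡g F.zero (s≤s z≤n) λ ())))))

  -- Via the intermediate sequence h, which agrees with f except at i and with f ∘ (i j) except at j.
  prefix-transpose-↭ : ∀ {n} (f : Fin n → A) {i j : Fin n} {d} → i < j → toℕ j Nat.< d →
    prefix d (λ k → f (transpose i j ⟨$⟩ʳ k)) ↭ prefix d f
  prefix-transpose-↭ f {i} {j} {d} i<j j<d
    with prefix-update-↭ f h i (NP.<-trans i<j j<d) (λ k _ k≢i → sym (updateAt-minimal k i f k≢i))
       | prefix-update-↭ h (λ k → f (transpose i j ⟨$⟩ʳ k)) j j<d h≡fσ
    where
    h : Fin _ → A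
    h = updateAt f i (λ _ → f j)
    h≡fσ : ∀ k → toℕ k Nat.< d → k ≢ j → h k ≡ f (transpose i j ⟨$⟩ʳ k)
    h≡fσ k _ k≢j with transposeView i j k
    ... | at-i            = trans (updateAt-updates i f) (cong f (sym (transpose-matchˡ i j)))
    ... | at-j            = ⊥-elim (k≢j refl)
    ... | elsewhere k≢i _ = trans (updateAt-minimal k i f k≢i) (cong f (sym (transpose-fix k≢i k≢j)))
  ... | zs₁ , f↭ , h↭₁ | zs₂ , h↭₂ , fσ↭ = begin
    prefix d (λ k → f (transpose i j ⟨$⟩ʳ k))  ↭⟨ fσ↭ ⟩
    (f (transpose i j ⟨$⟩ʳ j) ∷ zs₂)           ≡⟨ cong (λ x → f x ∷ zs₂) (transpose-matchʳ i j) ⟩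
    (f i ∷ zs₂)                                ↭⟨ ↭-prep (f i) (↭-sym zs₁↭zs₂) ⟩
    (f i ∷ zs₁)                                ↭⟨ f↭ ⟨
    prefix d f                                 ∎
    where
    open PermutationReasoning
    zs₁↭zs₂ : zs₁ ↭ zs₂
    zs₁↭zs₂ = drop-∷ (subst₂ (λ x y → x ∷ zs₁ ↭ y ∷ zs₂)
      (updateAt-updates i f) (updateAt-minimal j i f (FP.<⇒≢ i<j ∘ sym)) (↭-trans (↭-sym h↭₁) h↭₂))

module SortedPrefixes {a ℓ₁ ℓ₂} (O : DecTotalOrder a ℓ₁ ℓ₂) where
  open DecTotalOrder O renaming (Carrier to A; refl to ≤-refl; trans to ≤-trans)
  open import Relation.Binary.Properties.DecTotalOrder O using (≰⇒≥)
  open import Data.List.Sort O using (sort; sort-↭; sort-↗)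
  open import Data.List.Sort.InsertionSort.Base O using (insert)
  open import Data.List.Sort.InsertionSort.Properties O using (insert-↭; insert-↗)
  open import Data.List.Relation.Unary.Sorted.TotalOrder totalOrder using (Sorted)
  open import Data.List.Relation.Unary.Sorted.TotalOrder.Properties using (↗↭↗⇒≋)
  open import Data.List.Relation.Unary.Linked using (_∷_)
  import Data.List.Relation.Unary.Linked as Linked
  open import Data.List.Relation.Binary.Equality.Setoid Eq.setoid using (_≋_; ≋-sym)
  open import Data.List.Relation.Binary.Permutation.Propositional using (↭-prep; ↭⇒↭ₛ′)
  open import Data.List.Relation.Binary.Pointwise as PW using (Pointwise; []; _∷_)

  infix 4 _≤*_
  _≤*_ : List A → List A → Set _
  _≤*_ = Pointwise _≤_

  ≤*-refl : ∀ {xs} → xs ≤* xs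
  ≤*-refl = PW.refl ≤-refl

  ≤*-trans : ∀ {xs ys zs} → xs ≤* ys → ys ≤* zs → xs ≤* zs
  ≤*-trans = PW.transitive ≤-trans

  ≋⇒≤* : ∀ {xs ys} → xs ≋ ys → xs ≤* ys
  ≋⇒≤* = PW.map reflexive

  insert-lowerBound : ∀ {z zs y} → Sorted (z ∷ zs) → z ≤ y → z ∷ zs ≤* insert y zs
  insert-lowerBound {zs = []}         _             z≤y = z≤y ∷ []
  insert-lowerBound {zs = w ∷ zs} {y} (z≤w ∷ w∷zs↗) z≤y with y ≤? w
  ... | yes _  = z≤y ∷ ≤*-refl
  ... | no y≰w = z≤w ∷ insert-lowerBound w∷zs↗ (≰⇒≥ y≰w)

  insert-mono : ∀ {x y} zs → Sorted zs → x ≤ y → insert x zs ≤* insert y zs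
  insert-mono []               _     x≤y = x≤y ∷ []
  insert-mono {x} {y} (z ∷ zs) z∷zs↗ x≤y with x ≤? z | y ≤? z
  ... | yes _   | yes _   = x≤y ∷ ≤*-refl
  ... | yes x≤z | no y≰z  = x≤z ∷ insert-lowerBound z∷zs↗ (≰⇒≥ y≰z)
  ... | no x≰z  | yes y≤z = ⊥-elim (x≰z (≤-trans x≤y y≤z))
  ... | no _    | no _    = ≤-refl ∷ insert-mono zs (Linked.tail z∷zs↗) x≤y

  sorted-↭⇒≋ : ∀ {xs ys} → Sorted xs → Sorted ys → xs ↭ ys → xs ≋ ys
  sorted-↭⇒≋ xs↗ ys↗ xs↭ys = ↗↭↗⇒≋ totalOrder xs↗ ys↗ (↭⇒↭ₛ′ Eq.isEquivalence xs↭ys)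

  sort-cong-↭ : ∀ {xs ys} → xs ↭ ys → sort xs ≋ sort ys
  sort-cong-↭ {xs} {ys} xs↭ys =
    sorted-↭⇒≋ (sort-↗ xs) (sort-↗ ys) (↭-trans (sort-↭ xs) (↭-trans xs↭ys (↭-sym (sort-↭ ys))))

  sort-≋-insert : ∀ {xs x zs} → xs ↭ x ∷ zs → sort xs ≋ insert x (sort zs)
  sort-≋-insert {xs} {x} {zs} xs↭x∷zs = sorted-↭⇒≋ (sort-↗ xs) (insert-↗ x (sort-↗ zs)) (begin
    sort xs                ↭⟨ sort-↭ xs ⟩
    xs                     ↭⟨ xs↭x∷zs ⟩
    x ∷ zs                 ↭⟨ ↭-prep x (sort-↭ zs) ⟨
    x ∷ sort zs            ↭⟨ insert-↭ x (sort zs) ⟨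
    insert x (sort zs)     ∎)
    where open Data.List.Relation.Binary.Permutation.Propositional.PermutationReasoning

  sort-∷-mono : ∀ {xs ys x y zs} → xs ↭ x ∷ zs → ys ↭ y ∷ zs → x ≤ y → sort xs ≤* sort ys
  sort-∷-mono {zs = zs} xs↭ ys↭ x≤y =
    ≤*-trans (≋⇒≤* (sort-≋-insert xs↭))
   (≤*-trans (insert-mono (sort zs) (sort-↗ zs) x≤y)
             (≋⇒≤* (≋-sym (sort-≋-insert ys↭))))

  sort-prefix-transpose-mono : ∀ {n} (f : Fin n → A) {i j : Fin n} → i < j → f i ≤ f j → ∀ d →
    sort (prefix d f) ≤* sort (prefix d (λ k → f (transpose i j ⟨$⟩ʳ k)))
  sort-prefix-transpose-mono f {i} {j} i<j fi≤fj d with NP.≤-<-connex d (toℕ i)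
  ... | inj₁ d≤i = subst (λ zs → sort (prefix d f) ≤* sort zs) (prefix-cong d agree) ≤*-refl
    where
    agree : ∀ k → toℕ k Nat.< d → f k ≡ f (transpose i j ⟨$⟩ʳ k)
    agree k k<d = cong f (sym (transpose-fix (FP.<⇒≢ (NP.<-≤-trans k<d d≤i))
                                             (FP.<⇒≢ (NP.<-trans (NP.<-≤-trans k<d d≤i) i<j))))
  ... | inj₂ i<d with NP.≤-<-connex d (toℕ j)
  ...   | inj₁ d≤j with prefix-update-↭ f (λ k → f (transpose i j ⟨$⟩ʳ k)) i i<d agree
    where
    agree : ∀ k → toℕ k Nat.< d → k ≢ i → f k ≡ f (transpose i j ⟨$⟩ʳ k)
    agree k k<d k≢i = cong f (sym (transpose-fix k≢i (FP.<⇒≢ (NP.<-≤-trans k<d d≤j))))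
  ...     | _ , f↭ , fσ↭ = sort-∷-mono f↭ fσ↭ (subst (f i ≤_) (cong f (sym (transpose-matchˡ i j))) fi≤fj)
  sort-prefix-transpose-mono f {i} {j} i<j fi≤fj d | inj₂ i<d | inj₂ j<d =
    ≋⇒≤* (sort-cong-↭ (↭-sym (prefix-transpose-↭ f i<j j<d)))

-- The tableau criterion and the greedy rule

module _ {n : ℕ} where
  open SortedPrefixes (FP.≤-decTotalOrder n)
  open import Data.List.Sort (FP.≤-decTotalOrder n) using (sort)
  open import Relation.Binary.Definitions using (tri<; tri≈; tri>)

  wd≡sort-prefix : ∀ d (f : Perm n) → wd d f ≡ sort (prefix d (f ⟨$⟩ʳ_))
  wd≡sort-prefix d f = cong (sort ∘ take d) (LP.map-tabulate id (f ⟨$⟩ʳ_))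

  wd-cong : ∀ d {f g : Perm n} → (∀ k → f ⟨$⟩ʳ k ≡ g ⟨$⟩ʳ k) → wd d f ≡ wd d g
  wd-cong d {f} {g} f≗g = trans (wd≡sort-prefix d f)
    (trans (cong sort (prefix-cong d (λ k _ → f≗g k))) (sym (wd≡sort-prefix d g)))

  tableau-ascent : ∀ {f g : Perm n} {i j} → i < j → len f Nat.< len g →
    (∀ k → g ⟨$⟩ʳ k ≡ f ⟨$⟩ʳ (transpose i j ⟨$⟩ʳ k)) → ∀ d → wd d f ≤tup wd d g
  tableau-ascent {f} {g} {i} {j} i<j len-f<len-g g≗fσ d =
    subst₂ _≤*_ (sym (wd≡sort-prefix d f)) (sym wd-g≡sort-fσ)
      (sort-prefix-transpose-mono (f ⟨$⟩ʳ_) i<j fi≤fj d)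
    where
    fi≤fj : f ⟨$⟩ʳ i F.≤ f ⟨$⟩ʳ j
    fi≤fj = NP.≮⇒≥ (λ fj<fi → NP.<⇒≱ len-f<len-g
                     (SwapInversion.len-swapped≤len {f = f} {g} i<j fj<fi g≗fσ))
    wd-g≡sort-fσ : wd d g ≡ sort (prefix d (λ k → f ⟨$⟩ʳ (transpose i j ⟨$⟩ʳ k)))
    wd-g≡sort-fσ = trans (wd≡sort-prefix d g) (cong sort (prefix-cong d (λ k _ → g≗fσ k)))

  tmul≗transpose-positions : ∀ (a b : Fin n) (v : Perm n) k →
    tmul a b v ⟨$⟩ʳ k ≡ v ⟨$⟩ʳ (transpose (v ⟨$⟩ˡ a) (v ⟨$⟩ˡ b) ⟨$⟩ʳ k)
  tmul≗transpose-positions a b v k =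
    subst₂ (λ x y → transpose x y ⟨$⟩ʳ (v ⟨$⟩ʳ k) ≡ v ⟨$⟩ʳ (transpose (v ⟨$⟩ˡ a) (v ⟨$⟩ˡ b) ⟨$⟩ʳ k))
      (inverseʳ v) (inverseʳ v)
      (transpose-conjugate v (v ⟨$⟩ˡ a) (v ⟨$⟩ˡ b) k)

  bruhat-step-tableau : ∀ a b {v : Perm n} → len v Nat.< len (tmul a b v) →
                        ∀ d → wd d v ≤tup wd d (tmul a b v)
  bruhat-step-tableau a b {v} len-v<len-tv d with FP.<-cmp (v ⟨$⟩ˡ a) (v ⟨$⟩ˡ b)
  ... | tri< i<j _ _ =
    tableau-ascent {v} {tmul a b v} i<j len-v<len-tv (tmul≗transpose-positions a b v) d
  ... | tri> _ _ j<i = tableau-ascent {v} {tmul a b v} j<i len-v<len-tv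
    (λ k → trans (tmul≗transpose-positions a b v k)
                 (cong (v ⟨$⟩ʳ_) (transpose-comm (v ⟨$⟩ˡ a) (v ⟨$⟩ˡ b) k))) d
  ... | tri≈ _ i≡j _ = subst (wd d v ≤*_) (wd-cong d {v} {tmul a b v} v≗tv) ≤*-refl
    where
    v≗tv : ∀ k → v ⟨$⟩ʳ k ≡ tmul a b v ⟨$⟩ʳ k
    v≗tv k = sym (trans (tmul≗transpose-positions a b v k)
      (cong (v ⟨$⟩ʳ_) (trans (cong (λ x → transpose x (v ⟨$⟩ˡ b) ⟨$⟩ʳ k) i≡j)
                             (transpose-diag (v ⟨$⟩ˡ b) k))))

  bruhat⇒tableau : ∀ {u w : Perm n} → u ≤B w → ∀ d → wd d u ≤tup wd d w
  bruhat⇒tableau {u} {w} (base u≗w) d = subst (wd d u ≤*_) (wd-cong d {u} {w} u≗w) ≤*-refl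
  bruhat⇒tableau {u} {w} (step {v} a b u≤v len-v<len-tv w≗tv) d =
    ≤*-trans (bruhat⇒tableau {u} {v} u≤v d)
   (≤*-trans (bruhat-step-tableau a b {v} len-v<len-tv d)
             (subst (wd d (tmul a b v) ≤*_) (wd-cong d {tmul a b v} {w} (sym ∘ w≗tv)) ≤*-refl))

  greedy-order : ∀ {w v u : Perm n} {is} → Greedy w v is → (∀ k → v ⟨$⟩ʳ is k ≡ u ⟨$⟩ʳ k) →
    ∀ {p q} → p < q → tmul (u ⟨$⟩ʳ p) (u ⟨$⟩ʳ q) u ≤B w → is p F.≤ is q
  greedy-order {w} {v} {u} {is} greedy v∘is≗u {p} {q} p<q tu≤w =
    proj₂ (greedy p) (is q) (unused , admissible)
    where
    tu : Perm n
    tu = tmul (u ⟨$⟩ʳ p) (u ⟨$⟩ʳ q) u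
    unused : is q ∉ take (toℕ p) (map is (allFin n))
    unused = proj₁ (proj₁ (greedy q)) ∘ ∈-take-mono (map is (allFin n)) (NP.<⇒≤ p<q)
    agree-below-p : ∀ k → toℕ k Nat.< toℕ p → v ⟨$⟩ʳ is k ≡ tu ⟨$⟩ʳ k
    agree-below-p k k<p = trans (v∘is≗u k) (sym (transpose-fix
      (FP.<⇒≢ k<p ∘ perm-injective u) (FP.<⇒≢ (FP.<-trans k<p p<q) ∘ perm-injective u)))
    selected≡ : (v ⟨$⟩ʳ is q) ∷ take (toℕ p) (map (λ j → v ⟨$⟩ʳ is j) (allFin n))
              ≡ (tu ⟨$⟩ʳ p) ∷ prefix (toℕ p) (tu ⟨$⟩ʳ_)
    selected≡ = cong₂ _∷_ (trans (v∘is≗u q) (sym (transpose-matchˡ (u ⟨$⟩ʳ p) (u ⟨$⟩ʳ q))))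
                          (trans (cong (take (toℕ p)) (LP.map-tabulate id (λ j → v ⟨$⟩ʳ is j)))
                                 (prefix-cong (toℕ p) agree-below-p))
    selected↭ : (v ⟨$⟩ʳ is q) ∷ take (toℕ p) (map (λ j → v ⟨$⟩ʳ is j) (allFin n))
              ↭ prefix (suc (toℕ p)) (tu ⟨$⟩ʳ_)
    selected↭ = subst (_↭ prefix (suc (toℕ p)) (tu ⟨$⟩ʳ_)) (sym selected≡)
                      (↭-sym (prefix-suc-↭ (tu ⟨$⟩ʳ_) p))
    admissible : ((v ⟨$⟩ʳ is q) ∷ take (toℕ p) (map (λ j → v ⟨$⟩ʳ is j) (allFin n))) ↑
                 ≤tup wd (suc (toℕ p)) w
    admissible = ≤*-trans (≋⇒≤* (sort-cong-↭ selected↭))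
      (subst (_≤* wd (suc (toℕ p)) w) (wd≡sort-prefix (suc (toℕ p)) tu) (bruhat⇒tableau tu≤w (suc (toℕ p))))

-- Monotone vectors and dual cones

module _ {c ℓ₁ ℓ₂} (P : Preorder c ℓ₁ ℓ₂) where
  open Preorder P using (Carrier; _≲_) renaming (refl to ≲-refl; trans to ≲-trans)

  stepwise-monotone : ∀ {n} (h : Fin n → Carrier) → (∀ i j → toℕ j ≡ suc (toℕ i) → h i ≲ h j) →
                      ∀ {i j} → i F.≤ j → h i ≲ h j
  stepwise-monotone {n} h adjacent {i} {j} i≤j = by-distance (toℕ j Nat.∸ toℕ i) j (NP.m+[n∸m]≡n i≤j)
    where
    by-distance : ∀ k j → toℕ i Nat.+ k ≡ toℕ j → h i ≲ h j
    by-distance zero    j i+0≡j =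
      subst (λ t → h i ≲ h t) (FP.toℕ-injective (trans (sym (NP.+-identityʳ _)) i+0≡j)) ≲-refl
    by-distance (suc k) j i+1+k≡j =
      ≲-trans (by-distance k m (sym (FP.toℕ-fromℕ< i+k<n))) (adjacent m j j≡1+m)
      where
      1+i+k≡j : suc (toℕ i Nat.+ k) ≡ toℕ j
      1+i+k≡j = trans (sym (NP.+-suc (toℕ i) k)) i+1+k≡j
      i+k<n : toℕ i Nat.+ k Nat.< n
      i+k<n = NP.<-trans (NP.≤-reflexive 1+i+k≡j) (FP.toℕ<n j)
      m : Fin n
      m = F.fromℕ< i+k<n
      j≡1+m : toℕ j ≡ suc (toℕ m)
      j≡1+m = sym (trans (cong suc (FP.toℕ-fromℕ< i+k<n)) 1+i+k≡j)

module _ where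
  open Q using (_*_; _-_; -_; _≤_)

  0≤p∧0≤q⇒0≤p*q : ∀ {p q} → 0ℚ ≤ p → 0ℚ ≤ q → 0ℚ ≤ p * q
  0≤p∧0≤q⇒0≤p*q {p} {q} 0≤p 0≤q =
    QP.nonNegative⁻¹ (p * q) {{QP.nonNeg*nonNeg⇒nonNeg p {{Q.nonNegative 0≤p}} q {{Q.nonNegative 0≤q}}}}

  p≤q⇒0≤q-p : ∀ {p q} → p ≤ q → 0ℚ ≤ q - p
  p≤q⇒0≤q-p {p} {q} p≤q = subst (_≤ q - p) (QP.+-inverseʳ p) (QP.+-monoˡ-≤ (- p) p≤q)

module _ {n : ℕ} where
  open Q using (ℚ; 1ℚ; _+_; _*_; _-_; -_; _≤_)
  open import Data.Rational.Solver using (module +-*-Solver)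
  open import Algebra.Bundles using (CommutativeRing)
  open import Algebra.Properties.Semiring.Sum (CommutativeRing.semiring QP.+-*-commutativeRing)
    using (sum; sum-syntax; sum-cong-≗; ∑-distrib-+; *-distribˡ-sum; sum-remove; sum-replicate-zero)
  open import Data.List.Relation.Unary.All using (All; []; _∷_)

  sumℚ-tabulate : ∀ {m} (f : Fin m → ℚ) → sumℚ {n} (tabulate f) ≡ ∑[ i < m ] f i
  sumℚ-tabulate {zero}  f = refl
  sumℚ-tabulate {suc m} f = cong (f F.zero +_) (sumℚ-tabulate (f ∘ F.suc))

  ∑-supported : ∀ {m} (f : Fin m → ℚ) b → (∀ i → i ≢ b → f i ≡ 0ℚ) → ∑[ i < m ] f i ≡ f b
  ∑-supported {suc m} f b f≡0 = begin
    sum f                        ≡⟨ sum-remove {i = b} f ⟩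
    f b + sum (f ∘ F.punchIn b)  ≡⟨ cong (f b +_) (trans (sum-cong-≗ (λ k → f≡0 _ (FP.punchInᵢ≢i b k)))
                                                         (sum-replicate-zero m)) ⟩
    f b + 0ℚ                     ≡⟨ QP.+-identityʳ (f b) ⟩
    f b                          ∎
    where open ≡-Reasoning

  ⟨⟩≡∑ : (x y : Vecℚ {n}) → ⟨ x , y ⟩ ≡ ∑[ i < n ] (x i * y i)
  ⟨⟩≡∑ x y = trans (cong (sumℚ {n}) (LP.map-tabulate id (λ i → x i * y i)))
                   (sumℚ-tabulate (λ i → x i * y i))

  ⟨⟩-congʳ : (x : Vecℚ {n}) {y z : Vecℚ {n}} → (∀ i → y i ≡ z i) → ⟨ x , y ⟩ ≡ ⟨ x , z ⟩
  ⟨⟩-congʳ x y≗z = cong (sumℚ {n}) (LP.map-cong (λ i → cong (x i *_) (y≗z i)) (allFin n))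

  ⟨⟩-zeroʳ : (x : Vecℚ {n}) → ⟨ x , (λ _ → 0ℚ) ⟩ ≡ 0ℚ
  ⟨⟩-zeroʳ x = trans (⟨⟩≡∑ x _) (trans (sum-cong-≗ (λ i → QP.*-zeroʳ (x i))) (sum-replicate-zero n))

  ⟨⟩-linearʳ : (x : Vecℚ {n}) (c : ℚ) (y z : Vecℚ {n}) →
               ⟨ x , (λ i → c * y i + z i) ⟩ ≡ c * ⟨ x , y ⟩ + ⟨ x , z ⟩
  ⟨⟩-linearʳ x c y z = begin
    ⟨ x , (λ i → c * y i + z i) ⟩                       ≡⟨ ⟨⟩≡∑ x _ ⟩
    ∑[ i < n ] (x i * (c * y i + z i))                  ≡⟨ sum-cong-≗ (λ i → distrib (x i) (y i) (z i)) ⟩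
    ∑[ i < n ] (c * (x i * y i) + x i * z i)            ≡⟨ ∑-distrib-+ (λ i → c * (x i * y i)) (λ i → x i * z i) ⟩
    ∑[ i < n ] (c * (x i * y i)) + ∑[ i < n ] (x i * z i)
                                                        ≡⟨ cong (_+ _) (*-distribˡ-sum c (λ i → x i * y i)) ⟨
    c * ∑[ i < n ] (x i * y i) + ∑[ i < n ] (x i * z i) ≡⟨ cong₂ (λ s t → c * s + t) (⟨⟩≡∑ x y) (⟨⟩≡∑ x z) ⟨
    c * ⟨ x , y ⟩ + ⟨ x , z ⟩                           ∎
    where
    open ≡-Reasoning
    open +-*-Solver
    distrib : ∀ a b d → a * (c * b + d) ≡ c * (a * b) + a * d
    distrib = solve 4 (λ c a b d → a :* (c :* b :+ d) := c :* (a :* b) :+ a :* d) refl c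

  ⟨⟩-e : (x : Vecℚ {n}) (b : Fin n) → ⟨ x , e b ⟩ ≡ x b
  ⟨⟩-e x b = begin
    ⟨ x , e b ⟩               ≡⟨ ⟨⟩≡∑ x (e b) ⟩
    ∑[ i < n ] (x i * e b i)  ≡⟨ ∑-supported (λ i → x i * e b i) b off-b ⟩
    x b * e b b               ≡⟨ cong (λ t → x b * (if t then 1ℚ else 0ℚ)) (dec-true (b FP.≟ b) refl) ⟩
    x b * 1ℚ                  ≡⟨ QP.*-identityʳ (x b) ⟩
    x b                       ∎
    where
    open ≡-Reasoning
    off-b : ∀ i → i ≢ b → x i * e b i ≡ 0ℚ
    off-b i i≢b = trans (cong (λ t → x i * (if t then 1ℚ else 0ℚ)) (dec-false (i FP.≟ b) i≢b))
                        (QP.*-zeroʳ (x i))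

  ⟨⟩-e-difference : (x : Vecℚ {n}) {g : Vecℚ {n}} {a b : Fin n} → (∀ i → g i ≡ e b i - e a i) →
                    ⟨ x , g ⟩ ≡ x b - x a
  ⟨⟩-e-difference x {g} {a} {b} g≗eb-ea = begin
    ⟨ x , g ⟩                             ≡⟨ ⟨⟩-congʳ x (λ i → trans (g≗eb-ea i) (rearrange (e b i) (e a i))) ⟩
    ⟨ x , (λ i → - 1ℚ * e a i + e b i) ⟩  ≡⟨ ⟨⟩-linearʳ x (- 1ℚ) (e a) (e b) ⟩
    - 1ℚ * ⟨ x , e a ⟩ + ⟨ x , e b ⟩      ≡⟨ cong₂ (λ s t → - 1ℚ * s + t) (⟨⟩-e x a) (⟨⟩-e x b) ⟩
    - 1ℚ * x a + x b                      ≡⟨ rearrange (x b) (x a) ⟨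
    x b - x a                             ∎
    where
    open ≡-Reasoning
    open +-*-Solver
    rearrange : ∀ s t → s - t ≡ - 1ℚ * t + s
    rearrange = solve 2 (λ s t → s :- t := :- con 1ℚ :* t :+ s) refl

  Dual⇒Dual-Cone : ∀ {G : Vecℚ {n} → Set} {x : Vecℚ {n}} → Dual G x → Dual (Cone G) x
  Dual⇒Dual-Cone {G} {x} x∈G* y (gs , gs∈G , y≗) = subst (0ℚ ≤_) (sym (⟨⟩-congʳ x y≗)) (combination gs gs∈G)
    where
    combination : ∀ gs → All (λ cg → 0ℚ ≤ proj₁ cg × G (proj₂ cg)) gs →
                  0ℚ ≤ ⟨ x , (λ i → sumℚ {n} (map (λ cg → proj₁ cg * proj₂ cg i) gs)) ⟩
    combination [] [] = QP.≤-reflexive (sym (⟨⟩-zeroʳ x))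
    combination ((c , g) ∷ gs) ((0≤c , g∈G) ∷ gs∈G) =
      subst (0ℚ ≤_) (sym (⟨⟩-linearʳ x c g _))
        (QP.+-mono-≤ (0≤p∧0≤q⇒0≤p*q 0≤c (x∈G* g g∈G)) (combination gs gs∈G))

Etilde⇒ordered : ∀ {n} {w u v : Perm n} {x : Vecℚ {n}} → PrimeEq w v u → C v x →
                 ∀ {a b} → Etilde w u a b → x a Q.≤ x b
Etilde⇒ordered {w = w} {u} {v} {x} (is , greedy , v∘is≗u) x∈C (p , q , p<q , up≡a , uq≡b , tab≤w , _) =
  subst₂ (λ s t → x s Q.≤ x t) (trans (v∘is≗u p) up≡a) (trans (v∘is≗u q) uq≡b)
    (stepwise-monotone (TotalPreorder.preorder QP.≤-totalPreorder) (λ k → x (v ⟨$⟩ʳ k)) x∈C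
      (greedy-order {w = w} {v} {u} {is} greedy v∘is≗u p<q
        (subst₂ (λ s t → tmul s t u ≤B w) (sym up≡a) (sym uq≡b) tab≤w)))

lemma7p9 : ∀ (n : ℕ) (w u v : Perm n) → u ≤B w → PrimeEq w v u →
           ∀ (x : Vecℚ {n}) → C v x → Dual (Dw w u) x
lemma7p9 n w u v _ v′≡u x x∈C = Dual⇒Dual-Cone {n} {Generator} {x} generator-nonneg
  where
  Generator : Vecℚ {n} → Set
  Generator g = ∃₂ λ a b → E w u a b × (∀ i → g i ≡ e b i Q.- e a i)
  generator-nonneg : Dual Generator x
  generator-nonneg g (a , b , (ab∈Ẽ , _) , g≗eb-ea) =
    subst (0ℚ Q.≤_) (sym (⟨⟩-e-difference x g≗eb-ea))
      (p≤q⇒0≤q-p (Etilde⇒ordered {n} {w} {u} {v} {x} v′≡u x∈C ab∈Ẽ))
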